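{- Let $C$ be an $[n,k,d]_qR$ code and, for $m\ge1$, let $C_m$ be its $m$-lifted $[n,k,d]_{q^m}R_m$ code ($C_1=C$). Then $S(C_m)\subseteq S(C_{m+1})$ for all $m\ge1$, so $S(C_1)\subseteq S(C_2)\subseteq\cdots\subseteq\{d,d+1,\dots,n\}$ and $s(C_1)\le s(C_2)\le\cdots\le n-d+1$. If $S(C_{m^*})=\{d,d+1,\dots,n\}$ for some $m^*$, then $S(C_m)=\{d,\dots,n\}$ and $s(C_m)=n-d+1$ for all $m\ge m^*$. If $A_{d+1}(C_m)=0$ for all $m\ge m^*$ and $S(C_{m^*})=\{d,d+2,d+3,\dots,n\}$, then $S(C_m)=\{d,d+2,d+3,\dots,n\}$ and $s(C_m)=n-d$ for all $m\ge m^*$.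
   Context: An $[n,k,d]_qR$ code is a $k$-dimensional linear subspace of $\mathbb{F}_q^n$ with minimum distance $d$ and covering radius $R$. $A_i(C)$ is the number of codewords of weight $i$, $S(C)=\{i>0:A_i(C)\ne0\}$, $s(C)=|S(C)|$. For a linear code $C$ over $\mathbb{F}_q$ with parity check matrix $H$, the $m$-lifted code $C_m$ is $\{x\in\mathbb{F}_{q^m}^n:Hx^T=0\}$ (the $\mathbb{F}_{q^m}$-span of $C$); it has the same length, dimension and minimum distance. -}

module Defs where

open import Data.Nat as ℕ using (ℕ; zero; suc; _≤_; _<_; _∸_; _^_)
open import Data.Fin using (Fin)
open import Data.Fin.Properties using (all?)
open import Data.Vec using (Vec; []; _∷_; lookup; toList)
open import Data.List using (List; []; _∷_; length; filter; map; concatMap; applyUpTo)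
open import Data.List.Membership.Propositional using (_∈_)
open import Data.List.Relation.Unary.Unique.Propositional using (Unique)
open import Data.Product using (Σ; ∃; _×_; _,_)
open import Relation.Nullary using (¬_; Dec; ¬?)
open import Relation.Nullary.Decidable using (_×-dec_)
open import Relation.Binary.PropositionalEquality using (_≡_; _≢_)
open import Relation.Binary.Definitions using (DecidableEquality)
open import Algebra.Core using (Op₁; Op₂)
open import Algebra.Structures using (IsCommutativeRing)

record FiniteField : Set₁ where
  field
    Carrier : Set
    _+_ _*_ : Op₂ Carrier
    -_      : Op₁ Carrier
    0# 1#   : Carrier
    isCommutativeRing : IsCommutativeRing _≡_ _+_ _*_ -_ 0# 1#
    0≢1     : 0# ≢ 1#
    inverse : ∀ x → x ≢ 0# → ∃ λ y → x * y ≡ 1#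
    _≟_     : DecidableEquality Carrier
    elems   : List Carrier
    complete : ∀ x → x ∈ elems
    unique  : Unique elems

open FiniteField public using (Carrier)

order : FiniteField → ℕ
order F = length (FiniteField.elems F)

record Embedding (F E : FiniteField) : Set where
  private
    module F = FiniteField F
    module E = FiniteField E
  field
    ⟦_⟧   : F.Carrier → E.Carrier
    0-hom : ⟦ F.0# ⟧ ≡ E.0#
    1-hom : ⟦ F.1# ⟧ ≡ E.1#
    +-hom : ∀ x y → ⟦ x F.+ y ⟧ ≡ ⟦ x ⟧ E.+ ⟦ y ⟧
    *-hom : ∀ x y → ⟦ x F.* y ⟧ ≡ ⟦ x ⟧ E.* ⟦ y ⟧

open Embedding public using (⟦_⟧)

idEmb : (F : FiniteField) → Embedding F F
idEmb F = record { ⟦_⟧ = λ x → x ; 0-hom = _≡_.refl ; 1-hom = _≡_.refl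
                 ; +-hom = λ _ _ → _≡_.refl ; *-hom = λ _ _ → _≡_.refl }

module _ (E : FiniteField) where
  open FiniteField E hiding (Carrier)

  sumF : (n : ℕ) → (Fin n → Carrier E) → Carrier E
  sumF zero    f = 0#
  sumF (suc n) f = f Fin.zero + sumF n (λ i → f (Fin.suc i))

  allVecs : (n : ℕ) → List (Vec (Carrier E) n)
  allVecs zero    = [] ∷ []
  allVecs (suc n) = concatMap (λ a → map (a ∷_) (allVecs n)) elems

  wt : ∀ {n} → Vec (Carrier E) n → ℕ
  wt x = length (filter (λ a → ¬? (a ≟ 0#)) (toList x))

-- The m-lifted code: given a parity check matrix H (r × n) over F and an
-- extension E of F (via ι), the code {x ∈ Eⁿ : H xᵀ = 0}.
-- (With E = F, ι = id this is C itself.)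
module _ (F E : FiniteField) (ι : Embedding F E) {r n : ℕ}
         (H : Fin r → Fin n → Carrier F) where
  open FiniteField E hiding (Carrier)

  InCode : Vec (Carrier E) n → Set
  InCode x = ∀ j → sumF E n (λ i → ⟦ ι ⟧ (H j i) * lookup x i) ≡ 0#

  InCode? : (x : Vec (Carrier E) n) → Dec (InCode x)
  InCode? x = all? (λ j → sumF E n (λ i → ⟦ ι ⟧ (H j i) * lookup x i) ≟ 0#)

  A : ℕ → ℕ
  A i = length (filter (λ x → InCode? x ×-dec (wt E x ℕ.≟ i)) (allVecs E n))

  InS : ℕ → Set
  InS i = 0 < i × A i ≢ 0

  -- s(C) = |S(C)|  (weights are ≤ n, so it suffices to count i ∈ {1,…,n})
  s : ℕ
  s = length (filter (λ i → ¬? (A i ℕ.≟ 0)) (applyUpTo suc n))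

MinDist : (F : FiniteField) {r n : ℕ} → (Fin r → Fin n → Carrier F) → ℕ → Set
MinDist F H d = 1 ≤ d × A F F (idEmb F) H d ≢ 0
              × (∀ i → 1 ≤ i → i < d → A F F (idEmb F) H i ≡ 0)

-- Let q = |F| and fix a basis e₁,…,e_m of Eₘ over F. Writing every coordinate of x ∈ Eₘⁿ in this
-- basis gives x = Σₖ eₖ yₖ with columns yₖ ∈ Fⁿ; since H has entries in F, H xᵀ = 0 iff every yₖ
-- lies in C, and the support of x is the union of the supports of the yₖ. Hence a nonzero codeword
-- of Cₘ has a nonzero codeword of C inside its support, so its weight is at least d; and
-- reassembling the same columns with m independent elements of E_{m+1} gives a codeword of C_{m+1}
-- with the same support, so S(Cₘ) ⊆ S(C_{m+1}). Independent families of length j exist in every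
-- extension with at least q^j elements (choose greedily outside the span), and one of length m
-- spans Eₘ because its q^m combinations are pairwise distinct. The claims about s(Cₘ) are then
-- counts of weights in {1, …, n}.
module Submission where

open import Defs
open import Level using (Level; 0ℓ)
open import Algebra.Bundles using (CommutativeRing)
import Algebra.Properties.Ring as RingProperties
import Algebra.Properties.Semiring.Sum as SemiringSum
open import Data.Nat as ℕ
  using (ℕ; zero; suc; _∸_; _^_; _≤_; _<_; z≤n; s≤s; _≤′_; ≤′-refl; ≤′-step)
open import Data.Nat.Properties
  using (≤-trans; ≤-reflexive; ≤-antisym; ≤-pred; <-irrefl; <⇒≤; <⇒≱; ≰⇒>; _≤?_;
         ≤′⇒≤; ≤⇒≤′;
         n<1+n; n>0⇒n≢0; ^-monoʳ-<; +-comm; +-suc; +-identityʳ; +-monoʳ-≤; m≤m+n;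
         m+[n∸m]≡n; m+n∸m≡n; m≤n⇒m<n∨m≡n)
open import Data.Fin using (Fin)
import Data.Fin as Fin
open import Data.Fin.Properties using (¬∀⟶∃¬)
open import Data.List
  using (List; []; _∷_; _++_; length; map; filter; concatMap; cartesianProductWith; applyUpTo)
open import Data.List.Properties
  using (length-++; length-map; length-removeAt′; length-filter; length-applyUpTo;
         filter-++; filter-all; filter-none; filter-some; filter-accept; filter-reject)
open import Data.List.Membership.Propositional using (_∈_; _∉_; _─_)
open import Data.List.Membership.Propositional.Properties
  using (∈-map⁺; ∈-map⁻; ∈-filter⁺; ∈-filter⁻; ∈-length; ∈-cartesianProductWith⁺)
open import Data.List.Membership.DecPropositional using () renaming (_∈?_ to member?)
open import Data.List.Relation.Unary.Any using (here; there; satisfied)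
open import Data.List.Relation.Unary.All using ([]; _∷_)
import Data.List.Relation.Unary.All as All
open import Data.List.Relation.Unary.All.Properties using (¬All⇒Any¬; applyUpTo⁺₁)
open import Data.List.Relation.Unary.AllPairs using ([]; _∷_)
open import Data.List.Relation.Unary.Unique.Propositional using (Unique)
import Data.List.Relation.Unary.Unique.Propositional.Properties as Unique
open import Data.List.Relation.Binary.Subset.Propositional using (_⊆_)
open import Data.List.Relation.Binary.Pointwise using (Pointwise; []; _∷_)
open import Data.List.Relation.Binary.Pointwise.Properties using () renaming (refl to Pointwise-refl)
open import Data.List.Relation.Binary.Sublist.Heterogeneous.Properties
  using (length-mono-≤; fromPointwise; ⊆-filter-Sublist)
open import Data.Vec using (Vec; []; _∷_; lookup; tabulate; toList; zipWith)
import Data.Vec as Vec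
open import Data.Vec.Properties
  using (∷-injective; lookup-zipWith; lookup-map; lookup∘tabulate; tabulate∘lookup; tabulate-cong;
         length-toList)
open import Data.Vec.Membership.Propositional.Properties using (∈-lookup)
open import Data.Vec.Relation.Binary.Pointwise.Extensional using (ext; Pointwise-≡⇒≡)
import Data.Vec.Relation.Unary.All.Properties as VecAll
import Data.Vec.Relation.Unary.Any as VecAny
import Data.Vec.Relation.Unary.Any.Properties as VecAny
open import Data.Product using (Σ; ∃; _×_; _,_; proj₁; proj₂)
open import Data.Sum using (_⊎_; inj₁; inj₂)
open import Function.Base using (_∘_)
open import Function.Bundles using (_⇔_; mk⇔; Equivalence)
open import Relation.Nullary using (¬_; ¬?; Dec; yes; no; contradiction)
open import Relation.Nullary.Decidable using (_×-dec_)
open import Relation.Unary using (Pred; Decidable)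
open import Relation.Binary.Definitions using (DecidableEquality)
open import Relation.Binary.PropositionalEquality

private variable
  ℓ ℓ′ ℓ″ ℓp ℓq : Level
  X : Set ℓ
  Y : Set ℓ′
  Z : Set ℓ″

∈-─⁺ : ∀ {x y} {ys : List X} (y∈ys : y ∈ ys) → x ∈ ys → x ≢ y → x ∈ ys ─ y∈ys
∈-─⁺ (here refl)  (here refl)  x≢y = contradiction refl x≢y
∈-─⁺ (here refl)  (there x∈ys) x≢y = x∈ys
∈-─⁺ (there y∈ys) (here x≡z)   x≢y = here x≡z
∈-─⁺ (there y∈ys) (there x∈ys) x≢y = there (∈-─⁺ y∈ys x∈ys x≢y)

Unique-⊆⇒length≤ : {xs ys : List X} → Unique xs → xs ⊆ ys → length xs ≤ length ys
Unique-⊆⇒length≤ {xs = []}          _            _     = z≤n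
Unique-⊆⇒length≤ {xs = x ∷ xs} {ys} (x∉xs ∷ xs!) xs⊆ys =
  subst (length (x ∷ xs) ≤_) (sym (length-removeAt′ ys _))
    (s≤s (Unique-⊆⇒length≤ xs! λ z∈xs →
      ∈-─⁺ x∈ys (xs⊆ys (there z∈xs)) λ { refl → All.lookup x∉xs z∈xs refl }))
  where
  x∈ys : x ∈ ys
  x∈ys = xs⊆ys (here refl)

Unique-⊆-length≥⇒⊇ : DecidableEquality X → {xs ys : List X} → Unique xs → xs ⊆ ys →
                     length ys ≤ length xs → ys ⊆ xs
Unique-⊆-length≥⇒⊇ _≟_ {xs} {ys} xs! xs⊆ys ys≤xs {y} y∈ys with member? _≟_ y xs
... | yes y∈xs = y∈xs
... | no  y∉xs = contradiction (≤-trans longer ys≤xs) (<-irrefl refl)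
  where
  longer : length (y ∷ xs) ≤ length ys
  longer = Unique-⊆⇒length≤ (All.tabulate (λ { z∈xs refl → y∉xs z∈xs }) ∷ xs!)
             λ { (here refl) → y∈ys ; (there z∈xs) → xs⊆ys z∈xs }

length-filter-mono : {P : Pred X ℓp} {Q : Pred Y ℓq} (P? : Decidable P) (Q? : Decidable Q)
                     {xs : List X} {ys : List Y} → Pointwise (λ x y → P x → Q y) xs ys →
                     length (filter P? xs) ≤ length (filter Q? ys)
length-filter-mono P? Q? pw = length-mono-≤ (⊆-filter-Sublist P? Q? (λ r → r) (fromPointwise pw))

length-cartesianProductWith : ∀ (f : X → Y → Z) xs ys →
                              length (cartesianProductWith f xs ys) ≡ length xs ℕ.* length ys
length-cartesianProductWith f []       ys = refl
length-cartesianProductWith f (x ∷ xs) ys = trans (length-++ (map (f x) ys))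
  (cong₂ ℕ._+_ (length-map (f x) ys) (length-cartesianProductWith f xs ys))

Pointwise-toList : {R : X → Y → Set ℓp} → ∀ {n} {xs : Vec X n} {ys : Vec Y n} →
                   (∀ i → R (lookup xs i) (lookup ys i)) → Pointwise R (toList xs) (toList ys)
Pointwise-toList {xs = []}    {[]}    _ = []
Pointwise-toList {xs = _ ∷ _} {_ ∷ _} r = r Fin.zero ∷ Pointwise-toList (λ i → r (Fin.suc i))

module FieldProperties (K : FiniteField) where
  open FiniteField K public using (0≢1; inverse; _≟_; elems; complete; unique)

  commutativeRing : CommutativeRing 0ℓ 0ℓ
  commutativeRing = record { isCommutativeRing = FiniteField.isCommutativeRing K }

  open CommutativeRing commutativeRing public
    using (_+_; _*_; -_; _-_; 0#; 1#; +-identityˡ; *-assoc; *-comm; *-identityˡ; zeroˡ;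
           -‿inverseʳ; ring; semiring)
  open RingProperties ring public
    using (-1*x≈-x; -‿distribˡ-*; -‿distribʳ-*; -‿involutive; [y-z]x≈yx-zx;
           +-inverseʳ-unique; x∙y⁻¹≈ε⇒x≈y)
  open SemiringSum semiring public
    using (sum; sum-cong-≗; sum-replicate-zero; ∑-distrib-+; ∑-comm; *-distribˡ-sum; *-distribʳ-sum)

  sumF≡sum : ∀ n (f : Fin n → Carrier K) → sumF K n f ≡ sum f
  sumF≡sum zero    f = refl
  sumF≡sum (suc n) f = cong (f Fin.zero +_) (sumF≡sum n (λ i → f (Fin.suc i)))

  sum-neg : ∀ {n} (f : Fin n → Carrier K) → sum (λ i → - f i) ≡ - sum f
  sum-neg f = begin
    sum (λ i → - f i)         ≡⟨ sum-cong-≗ (λ i → -1*x≈-x (f i)) ⟨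
    sum (λ i → - 1# * f i)    ≡⟨ *-distribˡ-sum (- 1#) f ⟨
    - 1# * sum f              ≡⟨ -1*x≈-x (sum f) ⟩
    - sum f                   ∎
    where open ≡-Reasoning

  -x*-y≡x*y : ∀ x y → - x * - y ≡ x * y
  -x*-y≡x*y x y = begin
    - x * - y     ≡⟨ -‿distribˡ-* x (- y) ⟨
    - (x * - y)   ≡⟨ cong -_ (-‿distribʳ-* x y) ⟨
    - - (x * y)   ≡⟨ -‿involutive (x * y) ⟩
    x * y         ∎
    where open ≡-Reasoning

  2≤order : 2 ≤ order K
  2≤order = Unique-⊆⇒length≤ ((0≢1 ∷ []) ∷ [] ∷ []) λ {x} _ → complete x

  order^j<order^[1+j] : ∀ j → order K ^ j < order K ^ suc j
  order^j<order^[1+j] j = ^-monoʳ-< (order K) 2≤order (n<1+n j)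

module _ (K : FiniteField) where
  open FiniteField K using (elems; complete; unique)

  allVecs-suc : ∀ n → allVecs K (suc n) ≡ cartesianProductWith _∷_ elems (allVecs K n)
  allVecs-suc n = go elems
    where
    go : ∀ xs → concatMap (λ a → map (a ∷_) (allVecs K n)) xs ≡ cartesianProductWith _∷_ xs (allVecs K n)
    go []       = refl
    go (x ∷ xs) = cong (map (x ∷_) (allVecs K n) ++_) (go xs)

  ∈-allVecs : ∀ {n} (v : Vec (Carrier K) n) → v ∈ allVecs K n
  ∈-allVecs []      = here refl
  ∈-allVecs (a ∷ v) = subst ((a ∷ v) ∈_) (sym (allVecs-suc _))
                        (∈-cartesianProductWith⁺ _∷_ (complete a) (∈-allVecs v))

  allVecs-unique : ∀ n → Unique (allVecs K n)
  allVecs-unique zero    = [] ∷ []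
  allVecs-unique (suc n) = subst Unique (sym (allVecs-suc n))
    (Unique.cartesianProductWith⁺ _∷_ ∷-injective unique (allVecs-unique n))

  length-allVecs : ∀ n → length (allVecs K n) ≡ order K ^ n
  length-allVecs zero    = refl
  length-allVecs (suc n) = trans (cong length (allVecs-suc n))
    (trans (length-cartesianProductWith _∷_ elems (allVecs K n)) (cong (order K ℕ.*_) (length-allVecs n)))

module EmbeddingProperties {F K : FiniteField} (ι : Embedding F K) where
  private
    module F = FieldProperties F
    module K = FieldProperties K
  open Embedding ι

  ⟦⟧-neg : ∀ x → ⟦ ι ⟧ (F.- x) ≡ K.- ⟦ ι ⟧ x
  ⟦⟧-neg x = K.+-inverseʳ-unique (⟦ ι ⟧ x) (⟦ ι ⟧ (F.- x))
    (trans (sym (+-hom x (F.- x))) (trans (cong ⟦ ι ⟧ (F.-‿inverseʳ x)) 0-hom))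

  ⟦⟧-sum : ∀ {n} (f : Fin n → Carrier F) → ⟦ ι ⟧ (F.sum f) ≡ K.sum (λ i → ⟦ ι ⟧ (f i))
  ⟦⟧-sum {zero}  f = 0-hom
  ⟦⟧-sum {suc n} f = trans (+-hom _ _) (cong (⟦ ι ⟧ (f Fin.zero) K.+_) (⟦⟧-sum (λ i → f (Fin.suc i))))

  ⟦0⟧*x≡0 : ∀ {s} x → s ≡ F.0# → ⟦ ι ⟧ s K.* x ≡ K.0#
  ⟦0⟧*x≡0 x refl = trans (cong (K._* x) 0-hom) (K.zeroˡ x)

-- Coordinates over a subfield

module Coordinates {F K : FiniteField} (ι : Embedding F K) where
  private
    module F = FieldProperties F
    module K = FieldProperties K
  open Embedding ι
  open EmbeddingProperties ι

  term : ∀ {j} → Vec (Carrier K) j → Vec (Carrier F) j → Fin j → Carrier K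
  term e c k = ⟦ ι ⟧ (lookup c k) K.* lookup e k

  lincomb : ∀ {j} → Vec (Carrier K) j → Vec (Carrier F) j → Carrier K
  lincomb e c = K.sum (term e c)

  Independent : ∀ {j} → Vec (Carrier K) j → Set
  Independent e = ∀ c → lincomb e c ≡ K.0# → ∀ k → lookup c k ≡ F.0#

  Spanning : ∀ {j} → Vec (Carrier K) j → Set
  Spanning e = ∀ v → ∃ λ c → lincomb e c ≡ v

  span : ∀ {j} → Vec (Carrier K) j → List (Carrier K)
  span {j} e = map (lincomb e) (allVecs F j)

  lincomb-zero : ∀ {j} (e : Vec (Carrier K) j) c → (∀ k → lookup c k ≡ F.0#) → lincomb e c ≡ K.0#
  lincomb-zero {j} e c c≡0 = trans (K.sum-cong-≗ λ k → ⟦0⟧*x≡0 (lookup e k) (c≡0 k)) (K.sum-replicate-zero j)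

  lincomb-sub : ∀ {j} (e : Vec (Carrier K) j) c c′ →
                lincomb e (zipWith F._-_ c c′) ≡ lincomb e c K.- lincomb e c′
  lincomb-sub e c c′ = begin
    lincomb e (zipWith F._-_ c c′)                         ≡⟨ K.sum-cong-≗ term-sub ⟩
    K.sum (λ k → term e c k K.+ K.- term e c′ k)            ≡⟨ K.∑-distrib-+ (term e c) (λ k → K.- term e c′ k) ⟩
    lincomb e c K.+ K.sum (λ k → K.- term e c′ k)           ≡⟨ cong (lincomb e c K.+_) (K.sum-neg (term e c′)) ⟩
    lincomb e c K.- lincomb e c′                            ∎
    where
    open ≡-Reasoning
    term-sub : ∀ k → term e (zipWith F._-_ c c′) k ≡ term e c k K.- term e c′ k
    term-sub k = begin
      ⟦ ι ⟧ (lookup (zipWith F._-_ c c′) k) K.* lookup e k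
        ≡⟨ cong (λ x → ⟦ ι ⟧ x K.* lookup e k) (lookup-zipWith F._-_ k c c′) ⟩
      ⟦ ι ⟧ (lookup c k F.- lookup c′ k) K.* lookup e k
        ≡⟨ cong (K._* lookup e k) (trans (+-hom _ _) (cong (⟦ ι ⟧ (lookup c k) K.+_) (⟦⟧-neg _))) ⟩
      (⟦ ι ⟧ (lookup c k) K.- ⟦ ι ⟧ (lookup c′ k)) K.* lookup e k
        ≡⟨ K.[y-z]x≈yx-zx _ _ _ ⟩
      term e c k K.- term e c′ k ∎

  lincomb-scale : ∀ {j} (e : Vec (Carrier K) j) s c →
                  lincomb e (Vec.map (s F.*_) c) ≡ ⟦ ι ⟧ s K.* lincomb e c
  lincomb-scale e s c = trans (K.sum-cong-≗ term-scale) (sym (K.*-distribˡ-sum (⟦ ι ⟧ s) (term e c)))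
    where
    term-scale : ∀ k → term e (Vec.map (s F.*_) c) k ≡ ⟦ ι ⟧ s K.* term e c k
    term-scale k = trans (cong (λ x → ⟦ ι ⟧ x K.* lookup e k) (lookup-map k (s F.*_) c))
                     (trans (cong (K._* lookup e k) (*-hom s (lookup c k))) (K.*-assoc _ _ _))

  lincomb-injective : ∀ {j} (e : Vec (Carrier K) j) → Independent e →
                      ∀ {c c′} → lincomb e c ≡ lincomb e c′ → c ≡ c′
  lincomb-injective e ind {c} {c′} eq = Pointwise-≡⇒≡ (ext λ k →
    F.x∙y⁻¹≈ε⇒x≈y _ _ (trans (sym (lookup-zipWith F._-_ k c c′)) (ind (zipWith F._-_ c c′) difference≡0 k)))
    where
    difference≡0 : lincomb e (zipWith F._-_ c c′) ≡ K.0#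
    difference≡0 = trans (lincomb-sub e c c′) (trans (cong (K._- lincomb e c′) eq) (K.-‿inverseʳ _))

  ∈-span? : ∀ {j} (e : Vec (Carrier K) j) v → Dec (v ∈ span e)
  ∈-span? e v = member? K._≟_ v (span e)

  ∈-span : ∀ {j} (e : Vec (Carrier K) j) c → lincomb e c ∈ span e
  ∈-span e c = ∈-map⁺ (lincomb e) (∈-allVecs F c)

  length-span : ∀ {j} (e : Vec (Carrier K) j) → length (span e) ≡ order F ^ j
  length-span {j} e = trans (length-map (lincomb e) (allVecs F j)) (length-allVecs F j)

  Independent-∷ : ∀ {j} (e : Vec (Carrier K) j) {v} → Independent e → v ∉ span e → Independent (v ∷ e)
  Independent-∷ e {v} ind v∉span (s ∷ c) eq with s F.≟ F.0#
  ... | yes s≡0 = λ { Fin.zero → s≡0 ; (Fin.suc k) → ind c rest≡0 k }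
    where
    rest≡0 : lincomb e c ≡ K.0#
    rest≡0 = begin
      lincomb e c                         ≡⟨ K.+-identityˡ _ ⟨
      K.0# K.+ lincomb e c                ≡⟨ cong (K._+ lincomb e c) (⟦0⟧*x≡0 v s≡0) ⟨
      ⟦ ι ⟧ s K.* v K.+ lincomb e c       ≡⟨ eq ⟩
      K.0#                                ∎
      where open ≡-Reasoning
  ... | no s≢0 = contradiction (subst (_∈ span e) v-in-span (∈-span e c′)) v∉span
    where
    s⁻¹ : Carrier F
    s⁻¹ = proj₁ (F.inverse s s≢0)
    s⁻¹*s≡1 : s⁻¹ F.* s ≡ F.1#
    s⁻¹*s≡1 = trans (F.*-comm s⁻¹ s) (proj₂ (F.inverse s s≢0))
    c′ : Vec (Carrier F) _
    c′ = Vec.map (F.- s⁻¹ F.*_) c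
    v-in-span : lincomb e c′ ≡ v
    v-in-span = begin
      lincomb e c′                            ≡⟨ lincomb-scale e (F.- s⁻¹) c ⟩
      ⟦ ι ⟧ (F.- s⁻¹) K.* lincomb e c         ≡⟨ cong₂ K._*_ (⟦⟧-neg s⁻¹) (K.+-inverseʳ-unique _ _ eq) ⟩
      K.- ⟦ ι ⟧ s⁻¹ K.* K.- (⟦ ι ⟧ s K.* v)   ≡⟨ K.-x*-y≡x*y _ _ ⟩
      ⟦ ι ⟧ s⁻¹ K.* (⟦ ι ⟧ s K.* v)           ≡⟨ K.*-assoc _ _ _ ⟨
      ⟦ ι ⟧ s⁻¹ K.* ⟦ ι ⟧ s K.* v             ≡⟨ cong (K._* v) (*-hom s⁻¹ s) ⟨
      ⟦ ι ⟧ (s⁻¹ F.* s) K.* v                 ≡⟨ cong (λ x → ⟦ ι ⟧ x K.* v) s⁻¹*s≡1 ⟩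
      ⟦ ι ⟧ F.1# K.* v                        ≡⟨ cong (K._* v) 1-hom ⟩
      K.1# K.* v                              ≡⟨ K.*-identityˡ v ⟩
      v                                       ∎
      where open ≡-Reasoning

  span-complete⇒order≤ : ∀ {j} (e : Vec (Carrier K) j) → (∀ v → v ∈ span e) → order K ≤ order F ^ j
  span-complete⇒order≤ e complete = subst (order K ≤_) (length-span e)
    (Unique-⊆⇒length≤ K.unique λ {v} _ → complete v)

  -- Greedy: while q^j < |K| the q^j-element span misses some element of K.
  independent-family : ∀ j → order F ^ j ≤ order K → Σ (Vec (Carrier K) j) Independent
  independent-family zero    _    = [] , λ _ _ ()
  independent-family (suc j) room with independent-family j (≤-trans (<⇒≤ (F.order^j<order^[1+j] j)) room)
  ... | e , ind with All.all? (∈-span? e) K.elems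
  ...   | no some∉span = let v , v∉span = satisfied (¬All⇒Any¬ (∈-span? e) K.elems some∉span)
                         in v ∷ e , Independent-∷ e ind v∉span
  ...   | yes all∈span = contradiction
                           (≤-trans room (span-complete⇒order≤ e λ v → All.lookup all∈span (K.complete v)))
                           (<⇒≱ (F.order^j<order^[1+j] j))

  independent⇒span-complete : ∀ {j} (e : Vec (Carrier K) j) → order K ≤ order F ^ j → Independent e →
                              ∀ v → v ∈ span e
  independent⇒span-complete {j} e size ind v = Unique-⊆-length≥⇒⊇ K._≟_
    (Unique.map⁺ (lincomb-injective e ind) (allVecs-unique F j)) (λ {x} _ → K.complete x)
    (subst (order K ≤_) (sym (length-span e)) size) (K.complete v)

  independent⇒spanning : ∀ {j} (e : Vec (Carrier K) j) → order K ≤ order F ^ j → Independent e → Spanning e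
  independent⇒spanning e size ind v with ∈-map⁻ (lincomb e) (independent⇒span-complete e size ind v)
  ... | c , _ , v≡ = c , sym v≡

  sum-lincomb : ∀ {n j} (e : Vec (Carrier K) j) (h : Fin n → Carrier F) (a : Fin n → Vec (Carrier F) j) →
                K.sum (λ i → ⟦ ι ⟧ (h i) K.* lincomb e (a i))
                ≡ lincomb e (tabulate λ k → F.sum λ i → h i F.* lookup (a i) k)
  sum-lincomb {n} {j} e h a = begin
    K.sum (λ i → ⟦ ι ⟧ (h i) K.* lincomb e (a i))
      ≡⟨ K.sum-cong-≗ (λ i → K.*-distribˡ-sum (⟦ ι ⟧ (h i)) (term e (a i))) ⟩
    K.sum (λ i → K.sum λ k → ⟦ ι ⟧ (h i) K.* term e (a i) k)
      ≡⟨ K.sum-cong-≗ (λ i → K.sum-cong-≗ λ k → merge i k) ⟩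
    K.sum (λ i → K.sum λ k → ⟦ ι ⟧ (h i F.* a[ i , k ]) K.* lookup e k)
      ≡⟨ K.∑-comm (λ i k → ⟦ ι ⟧ (h i F.* a[ i , k ]) K.* lookup e k) ⟩
    K.sum (λ k → K.sum λ i → ⟦ ι ⟧ (h i F.* a[ i , k ]) K.* lookup e k)
      ≡⟨ K.sum-cong-≗ (λ k → K.*-distribʳ-sum (lookup e k) (λ i → ⟦ ι ⟧ (h i F.* a[ i , k ]))) ⟨
    K.sum (λ k → K.sum (λ i → ⟦ ι ⟧ (h i F.* a[ i , k ])) K.* lookup e k)
      ≡⟨ K.sum-cong-≗ (λ k → cong (K._* lookup e k) (pull k)) ⟩
    lincomb e (tabulate coefficient) ∎
    where
    open ≡-Reasoning
    a[_,_] : Fin n → Fin j → Carrier F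
    a[ i , k ] = lookup (a i) k
    coefficient : Fin j → Carrier F
    coefficient k = F.sum λ i → h i F.* a[ i , k ]
    merge : ∀ i k → ⟦ ι ⟧ (h i) K.* term e (a i) k ≡ ⟦ ι ⟧ (h i F.* a[ i , k ]) K.* lookup e k
    merge i k = trans (sym (K.*-assoc _ _ _)) (cong (K._* lookup e k) (sym (*-hom (h i) a[ i , k ])))
    pull : ∀ k → K.sum (λ i → ⟦ ι ⟧ (h i F.* a[ i , k ])) ≡ ⟦ ι ⟧ (lookup (tabulate coefficient) k)
    pull k = trans (sym (⟦⟧-sum λ i → h i F.* a[ i , k ])) (cong ⟦ ι ⟧ (sym (lookup∘tabulate coefficient k)))

nonzero? : ∀ K → Decidable (λ (a : Carrier K) → a ≢ FiniteField.0# K)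
nonzero? K a = ¬? (FiniteField._≟_ K a (FiniteField.0# K))

module _ (K : FiniteField) where
  open FiniteField K using (_≟_; 0#)

  wt≤length : ∀ {n} (x : Vec (Carrier K) n) → wt K x ≤ n
  wt≤length x = ≤-trans (length-filter (nonzero? K) (toList x)) (≤-reflexive (length-toList x))

  nonzero⇒0<wt : ∀ {n} (x : Vec (Carrier K) n) i → lookup x i ≢ 0# → 0 < wt K x
  nonzero⇒0<wt x i x≢0 =
    filter-some (nonzero? K) (VecAny.toList⁺ {xs = x} (VecAny.map (λ { refl → x≢0 }) (∈-lookup i x)))

  0<wt⇒nonzero : ∀ {n} (x : Vec (Carrier K) n) → 0 < wt K x → ∃ λ i → lookup x i ≢ 0#
  0<wt⇒nonzero {n} x 0<wt = ¬∀⟶∃¬ n _ (λ i → lookup x i ≟ 0#) λ x≡0 →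
    <-irrefl (sym (cong length (filter-none (nonzero? K)
      (VecAll.toList⁺ (VecAll.lookup⁻ {xs = x} λ i x≢0 → x≢0 (x≡0 i)))))) 0<wt

wt-mono : ∀ (K L : FiniteField) {n} (x : Vec (Carrier K) n) (y : Vec (Carrier L) n) →
          (∀ i → lookup x i ≢ FiniteField.0# K → lookup y i ≢ FiniteField.0# L) → wt K x ≤ wt L y
wt-mono K L x y supp = length-filter-mono (nonzero? K) (nonzero? L) (Pointwise-toList {xs = x} {ys = y} supp)

-- Lifted codes

module _ (F : FiniteField) {r n} (H : Fin r → Fin n → Carrier F) (K : FiniteField) (ι : Embedding F K) where

  codeword⇒A≢0 : ∀ x → InCode F K ι H x → A F K ι H (wt K x) ≢ 0
  codeword⇒A≢0 x x∈C = n>0⇒n≢0 (∈-length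
    (∈-filter⁺ (λ y → InCode? F K ι H y ×-dec (wt K y ℕ.≟ wt K x)) (∈-allVecs K x) (x∈C , refl)))

  A≢0⇒codeword : ∀ i → A F K ι H i ≢ 0 → ∃ λ x → InCode F K ι H x × wt K x ≡ i
  A≢0⇒codeword i A≢0 with filter (λ y → InCode? F K ι H y ×-dec (wt K y ℕ.≟ i)) (allVecs K n) in eq
  ... | []    = contradiction refl A≢0
  ... | x ∷ _ = x , proj₂ (∈-filter⁻ (λ y → InCode? F K ι H y ×-dec (wt K y ℕ.≟ i)) {xs = allVecs K n}
                                      (subst (x ∈_) (sym eq) (here refl)))

  A≢0⇒≤length : ∀ {i} → A F K ι H i ≢ 0 → i ≤ n
  A≢0⇒≤length {i} A≢0 with A≢0⇒codeword i A≢0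
  ... | x , _ , refl = wt≤length K x

module CoordinateExpansion (F : FiniteField) {r n} (H : Fin r → Fin n → Carrier F)
                           {K : FiniteField} (ι : Embedding F K) where
  private
    module F = FieldProperties F
    module K = FieldProperties K
  open Coordinates ι

  expand : ∀ {j} → Vec (Carrier K) j → (Fin n → Vec (Carrier F) j) → Vec (Carrier K) n
  expand e a = tabulate λ i → lincomb e (a i)

  column : ∀ {j} → (Fin n → Vec (Carrier F) j) → Fin j → Vec (Carrier F) n
  column a k = tabulate λ i → lookup (a i) k

  coordinates : ∀ {j} (e : Vec (Carrier K) j) → Spanning e →
                Vec (Carrier K) n → Fin n → Vec (Carrier F) j
  coordinates e spans x i = proj₁ (spans (lookup x i))

  expand-coordinates : ∀ {j} (e : Vec (Carrier K) j) (spans : Spanning e) x →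
                       expand e (coordinates e spans x) ≡ x
  expand-coordinates e spans x = trans (tabulate-cong λ i → proj₂ (spans (lookup x i))) (tabulate∘lookup x)

  private
    syndrome : ∀ {j} → (Fin n → Vec (Carrier F) j) → Fin r → Vec (Carrier F) j
    syndrome a row = tabulate λ k → F.sum λ i → H row i F.* lookup (a i) k

    syndrome-expand : ∀ {j} e (a : Fin n → Vec (Carrier F) j) row →
                      sumF K n (λ i → ⟦ ι ⟧ (H row i) K.* lookup (expand e a) i) ≡ lincomb e (syndrome a row)
    syndrome-expand e a row = trans (K.sumF≡sum n _)
      (trans (K.sum-cong-≗ λ i → cong (⟦ ι ⟧ (H row i) K.*_) (lookup∘tabulate _ i)) (sum-lincomb e (H row) a))

    syndrome-column : ∀ {j} (a : Fin n → Vec (Carrier F) j) row k →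
                      sumF F n (λ i → H row i F.* lookup (column a k) i) ≡ lookup (syndrome a row) k
    syndrome-column a row k = trans (F.sumF≡sum n _)
      (trans (F.sum-cong-≗ λ i → cong (H row i F.*_) (lookup∘tabulate _ i)) (sym (lookup∘tabulate _ k)))

  columns⇒expand : ∀ {j} (e : Vec (Carrier K) j) a →
                   (∀ k → InCode F F (idEmb F) H (column a k)) → InCode F K ι H (expand e a)
  columns⇒expand e a columns∈C row = trans (syndrome-expand e a row)
    (lincomb-zero e (syndrome a row) λ k → trans (sym (syndrome-column a row k)) (columns∈C k row))

  expand⇒columns : ∀ {j} (e : Vec (Carrier K) j) → Independent e → ∀ a →
                   InCode F K ι H (expand e a) → ∀ k → InCode F F (idEmb F) H (column a k)
  expand⇒columns e ind a x∈C k row = trans (syndrome-column a row k)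
    (ind (syndrome a row) (trans (sym (syndrome-expand e a row)) (x∈C row)) k)

  expand≡0⇒row≡0 : ∀ {j} (e : Vec (Carrier K) j) → Independent e → ∀ a i →
                   lookup (expand e a) i ≡ K.0# → ∀ k → lookup (a i) k ≡ F.0#
  expand≡0⇒row≡0 e ind a i x≡0 = ind (a i) (trans (sym (lookup∘tabulate _ i)) x≡0)

  row≡0⇒expand≡0 : ∀ {j} (e : Vec (Carrier K) j) a i →
                   (∀ k → lookup (a i) k ≡ F.0#) → lookup (expand e a) i ≡ K.0#
  row≡0⇒expand≡0 e a i row≡0 = trans (lookup∘tabulate _ i) (lincomb-zero e (a i) row≡0)

  0<wt-expand⇒0<wt-column : ∀ {j} (e : Vec (Carrier K) j) a →
                            0 < wt K (expand e a) → ∃ λ k → 0 < wt F (column a k)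
  0<wt-expand⇒0<wt-column {j} e a 0<wt with 0<wt⇒nonzero K (expand e a) 0<wt
  ... | i , x≢0 with ¬∀⟶∃¬ j _ (λ k → lookup (a i) k F.≟ F.0#) (x≢0 ∘ row≡0⇒expand≡0 e a i)
  ...   | k , a≢0 = k , nonzero⇒0<wt F (column a k) i λ y≡0 → a≢0 (trans (sym (lookup∘tabulate _ i)) y≡0)

  wt-column≤wt-expand : ∀ {j} (e : Vec (Carrier K) j) → Independent e → ∀ a k →
                        wt F (column a k) ≤ wt K (expand e a)
  wt-column≤wt-expand e ind a k = wt-mono F K (column a k) (expand e a) λ i y≢0 x≡0 →
    y≢0 (trans (lookup∘tabulate _ i) (expand≡0⇒row≡0 e ind a i x≡0 k))

module _ (F : FiniteField) {r n} (H : Fin r → Fin n → Carrier F) where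
  open Coordinates using (Independent; Spanning)

  wt-expand-independent : ∀ {K₁ K₂ : FiniteField} (ι₁ : Embedding F K₁) (ι₂ : Embedding F K₂) {j}
                          (e₁ : Vec (Carrier K₁) j) (e₂ : Vec (Carrier K₂) j) →
                          Independent ι₁ e₁ → Independent ι₂ e₂ → ∀ a →
                          wt K₁ (CoordinateExpansion.expand F H ι₁ e₁ a)
                          ≡ wt K₂ (CoordinateExpansion.expand F H ι₂ e₂ a)
  wt-expand-independent {K₁} {K₂} ι₁ ι₂ e₁ e₂ ind₁ ind₂ a = ≤-antisym
      (wt-mono K₁ K₂ (E₁.expand e₁ a) (E₂.expand e₂ a) λ i x≢0 y≡0 →
        x≢0 (E₁.row≡0⇒expand≡0 e₁ a i (E₂.expand≡0⇒row≡0 e₂ ind₂ a i y≡0)))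
      (wt-mono K₂ K₁ (E₂.expand e₂ a) (E₁.expand e₁ a) λ i y≢0 x≡0 →
        y≢0 (E₂.row≡0⇒expand≡0 e₂ a i (E₁.expand≡0⇒row≡0 e₁ ind₁ a i x≡0)))
    where
    module E₁ = CoordinateExpansion F H ι₁
    module E₂ = CoordinateExpansion F H ι₂

  A≢0-transfer : ∀ {K₁ K₂ : FiniteField} (ι₁ : Embedding F K₁) (ι₂ : Embedding F K₂) {j}
                 (e₁ : Vec (Carrier K₁) j) (e₂ : Vec (Carrier K₂) j) →
                 Independent ι₁ e₁ → Spanning ι₁ e₁ → Independent ι₂ e₂ →
                 ∀ {i} → A F K₁ ι₁ H i ≢ 0 → A F K₂ ι₂ H i ≢ 0
  A≢0-transfer {K₁} {K₂} ι₁ ι₂ {j} e₁ e₂ ind₁ spans₁ ind₂ {i} A≢0 with A≢0⇒codeword F H K₁ ι₁ i A≢0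
  ... | x , x∈C , refl =
    subst (λ w → A F K₂ ι₂ H w ≢ 0) same-wt (codeword⇒A≢0 F H K₂ ι₂ (E₂.expand e₂ a) x′∈C)
    where
    module E₁ = CoordinateExpansion F H ι₁
    module E₂ = CoordinateExpansion F H ι₂
    a : Fin n → Vec (Carrier F) j
    a = E₁.coordinates e₁ spans₁ x
    x≡ : E₁.expand e₁ a ≡ x
    x≡ = E₁.expand-coordinates e₁ spans₁ x
    x′∈C : InCode F K₂ ι₂ H (E₂.expand e₂ a)
    x′∈C = E₂.columns⇒expand e₂ a
             (E₁.expand⇒columns e₁ ind₁ a (subst (InCode F K₁ ι₁ H) (sym x≡) x∈C))
    same-wt : wt K₂ (E₂.expand e₂ a) ≡ wt K₁ x
    same-wt = trans (wt-expand-independent ι₂ ι₁ e₂ e₁ ind₂ ind₁ a) (cong (wt K₁) x≡)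

  nonzero-codeword-wt≥ : ∀ d → (∀ w → 1 ≤ w → w < d → A F F (idEmb F) H w ≡ 0) →
                         ∀ y → InCode F F (idEmb F) H y → 0 < wt F y → d ≤ wt F y
  nonzero-codeword-wt≥ d below-d y y∈C 0<wt with d ≤? wt F y
  ... | yes d≤wt = d≤wt
  ... | no  d≰wt = contradiction (below-d (wt F y) 0<wt (≰⇒> d≰wt)) (codeword⇒A≢0 F H F (idEmb F) y y∈C)

  nonzero-expansion-wt≥ : ∀ {K : FiniteField} (ι : Embedding F K) {j} (e : Vec (Carrier K) j) →
                          Independent ι e → ∀ d → (∀ w → 1 ≤ w → w < d → A F F (idEmb F) H w ≡ 0) →
                          ∀ a → InCode F K ι H (CoordinateExpansion.expand F H ι e a) →
                          0 < wt K (CoordinateExpansion.expand F H ι e a) →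
                          d ≤ wt K (CoordinateExpansion.expand F H ι e a)
  nonzero-expansion-wt≥ ι e ind d below-d a x∈C 0<wt with E.0<wt-expand⇒0<wt-column e a 0<wt
    where module E = CoordinateExpansion F H ι
  ... | k , 0<wt-column = ≤-trans
    (nonzero-codeword-wt≥ d below-d (E.column a k) (E.expand⇒columns e ind a x∈C k) 0<wt-column)
    (E.wt-column≤wt-expand e ind a k)
    where module E = CoordinateExpansion F H ι

  A≢0⇒d≤ : ∀ {K : FiniteField} (ι : Embedding F K) {j} (e : Vec (Carrier K) j) →
           Independent ι e → Spanning ι e → ∀ d → (∀ w → 1 ≤ w → w < d → A F F (idEmb F) H w ≡ 0) →
           ∀ {i} → 0 < i → A F K ι H i ≢ 0 → d ≤ i
  A≢0⇒d≤ {K} ι {j} e ind spans d below-d {i} 0<i A≢0 with A≢0⇒codeword F H K ι i A≢0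
  ... | x , x∈C , refl = subst (λ y → d ≤ wt K y) x≡
    (nonzero-expansion-wt≥ ι e ind d below-d a (subst (InCode F K ι H) (sym x≡) x∈C)
                           (subst (λ y → 0 < wt K y) (sym x≡) 0<i))
    where
    module E = CoordinateExpansion F H ι
    a : Fin n → Vec (Carrier F) j
    a = E.coordinates e spans x
    x≡ : E.expand e a ≡ x
    x≡ = E.expand-coordinates e spans x

-- Counting weights

open import Data.Nat using (_+_)

upward : (P : ℕ → Set ℓ) → (∀ {m} → 1 ≤ m → P m → P (suc m)) →
         ∀ {a b} → 1 ≤ a → a ≤ b → P a → P b
upward P step {a} 1≤a a≤b = go (≤⇒≤′ a≤b)
  where
  go : ∀ {b} → a ≤′ b → P a → P b
  go ≤′-refl        pa = pa
  go (≤′-step a≤′b) pa = step (≤-trans 1≤a (≤′⇒≤ a≤′b)) (go a≤′b pa)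

applyUpTo-+ : ∀ (f : ℕ → X) m n → applyUpTo f (m + n) ≡ applyUpTo f m ++ applyUpTo (λ i → f (m + i)) n
applyUpTo-+ f zero    n = refl
applyUpTo-+ f (suc m) n = cong (f 0 ∷_) (applyUpTo-+ (λ i → f (suc i)) m n)

module _ {P : Pred ℕ 0ℓ} (P? : Decidable P) where

  countUpTo : ℕ → ℕ
  countUpTo n = length (filter P? (applyUpTo suc n))

  private
    length-filter-all : ∀ f k → (∀ {i} → i < k → P (f i)) → length (filter P? (applyUpTo f k)) ≡ k
    length-filter-all f k all = trans (cong length (filter-all P? (applyUpTo⁺₁ f k all))) (length-applyUpTo f k)

  countUpTo-+ : ∀ c k → (∀ {i} → i < c → ¬ P (suc i)) →
                countUpTo (c + k) ≡ length (filter P? (applyUpTo (λ i → suc (c + i)) k))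
  countUpTo-+ c k none = begin
    length (filter P? (applyUpTo suc (c + k)))
      ≡⟨ cong (λ xs → length (filter P? xs)) (applyUpTo-+ suc c k) ⟩
    length (filter P? (applyUpTo suc c ++ block))
      ≡⟨ cong length (filter-++ P? (applyUpTo suc c) block) ⟩
    length (filter P? (applyUpTo suc c) ++ filter P? block)
      ≡⟨ length-++ (filter P? (applyUpTo suc c)) ⟩
    length (filter P? (applyUpTo suc c)) + length (filter P? block)
      ≡⟨ cong (λ xs → length xs + length (filter P? block)) (filter-none P? (applyUpTo⁺₁ suc c none)) ⟩
    length (filter P? block) ∎
    where
    open ≡-Reasoning
    block : List ℕ
    block = applyUpTo (λ i → suc (c + i)) k

  countUpTo-≤ : ∀ c k → (∀ {i} → i < c → ¬ P (suc i)) → countUpTo (c + k) ≤ k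
  countUpTo-≤ c k none = subst (_≤ k) (sym (countUpTo-+ c k none))
    (≤-trans (length-filter P? block) (≤-reflexive (length-applyUpTo _ k)))
    where
    block : List ℕ
    block = applyUpTo (λ i → suc (c + i)) k

  countUpTo-interval : ∀ c k → (∀ {i} → i < c → ¬ P (suc i)) → (∀ {i} → i < k → P (suc (c + i))) →
                       countUpTo (c + k) ≡ k
  countUpTo-interval c k none all = trans (countUpTo-+ c k none) (length-filter-all _ k all)

  countUpTo-gap : ∀ c k → (∀ {i} → i < c → ¬ P (suc i)) → P (suc c) → ¬ P (suc (suc c)) →
                  (∀ {i} → i < k → P (suc (c + suc (suc i)))) → countUpTo (c + suc (suc k)) ≡ suc k
  countUpTo-gap c k none first ¬second rest = begin
    countUpTo (c + suc (suc k))
      ≡⟨ countUpTo-+ c (suc (suc k)) none ⟩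
    length (filter P? (suc (c + 0) ∷ suc (c + 1) ∷ applyUpTo (λ i → suc (c + suc (suc i))) k))
      ≡⟨ cong length (filter-accept P? (subst (λ x → P (suc x)) (sym (+-identityʳ c)) first)) ⟩
    suc (length (filter P? (suc (c + 1) ∷ applyUpTo (λ i → suc (c + suc (suc i))) k)))
      ≡⟨ cong (λ xs → suc (length xs)) (filter-reject P? (subst (λ x → ¬ P (suc x)) (+-comm 1 c) ¬second)) ⟩
    suc (length (filter P? (applyUpTo (λ i → suc (c + suc (suc i))) k)))
      ≡⟨ cong suc (length-filter-all _ k rest) ⟩
    suc k ∎
    where open ≡-Reasoning

in-block : ∀ {c k n i} → c + k ≡ n → i < k → suc (c + i) ≤ n
in-block {c} {k} {n} {i} c+k≡n i<k =
  subst (suc (c + i) ≤_) c+k≡n (subst (_≤ c + k) (+-suc c i) (+-monoʳ-≤ c i<k))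

-- The weight spectra of the lifted codes

module LiftedCodes (F : FiniteField) (E : ℕ → FiniteField) (ι : ∀ m → Embedding F (E m))
                   (sizeE : ∀ m → 1 ≤ m → order (E m) ≡ order F ^ m)
                   {r n : ℕ} (H : Fin r → Fin n → Carrier F) (d′ : ℕ) (md : MinDist F H (suc d′)) where
  open Coordinates using (Independent; Spanning; independent-family; independent⇒spanning)

  private
    d : ℕ
    d = suc d′
    Aₘ : ℕ → ℕ → ℕ
    Aₘ m = A F (E m) (ι m) H
    InSₘ : ℕ → ℕ → Set
    InSₘ m = InS F (E m) (ι m) H
    sₘ : ℕ → ℕ
    sₘ m = s F (E m) (ι m) H
    -- sₘ m unfolds to countUpTo (Aₘ≢0? m) n.
    Aₘ≢0? : ∀ m → Decidable (λ i → Aₘ m i ≢ 0)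
    Aₘ≢0? m i = ¬? (Aₘ m i ℕ.≟ 0)

  basis : ∀ m → 1 ≤ m → Σ (Vec (Carrier (E m)) m) λ e → Independent (ι m) e × Spanning (ι m) e
  basis m 1≤m with independent-family (ι m) m (≤-reflexive (sym (sizeE m 1≤m)))
  ... | e , ind = e , ind , independent⇒spanning (ι m) e (≤-reflexive (sizeE m 1≤m)) ind

  independent-in-next : ∀ m → Σ (Vec (Carrier (E (suc m))) m) (Independent (ι (suc m)))
  independent-in-next m = independent-family (ι (suc m)) m
    (subst (order F ^ m ≤_) (sym (sizeE (suc m) (s≤s z≤n))) (<⇒≤ (FieldProperties.order^j<order^[1+j] F m)))

  A≢0-step : ∀ m → 1 ≤ m → ∀ {i} → Aₘ m i ≢ 0 → Aₘ (suc m) i ≢ 0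
  A≢0-step m 1≤m with basis m 1≤m | independent-in-next m
  ... | e , ind , spans | e′ , ind′ = A≢0-transfer F H (ι m) (ι (suc m)) e e′ ind spans ind′

  InS-step : ∀ m → 1 ≤ m → ∀ i → InSₘ m i → InSₘ (suc m) i
  InS-step m 1≤m i (0<i , A≢0) = 0<i , A≢0-step m 1≤m A≢0

  InS-bounds : ∀ m → 1 ≤ m → ∀ i → InSₘ m i → d ≤ i × i ≤ n
  InS-bounds m 1≤m i (0<i , A≢0) with basis m 1≤m
  ... | e , ind , spans = A≢0⇒d≤ F H (ι m) e ind spans d (proj₂ (proj₂ md)) 0<i A≢0
                        , A≢0⇒≤length F H (E m) (ι m) A≢0

  InS-lift : ∀ {m* m} → 1 ≤ m* → m* ≤ m → ∀ i → InSₘ m* i → InSₘ m i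
  InS-lift 1≤m* m*≤m i = upward (λ m → InSₘ m i) (λ 1≤m → InS-step _ 1≤m i) 1≤m* m*≤m

  no-weight-below-d : ∀ m → 1 ≤ m → ∀ {i} → i < d′ → ¬ (Aₘ m (suc i) ≢ 0)
  no-weight-below-d m 1≤m {i} i<d′ A≢0 =
    <⇒≱ i<d′ (≤-pred (proj₁ (InS-bounds m 1≤m (suc i) (s≤s z≤n , A≢0))))

  s-step : ∀ m → 1 ≤ m → sₘ m ≤ sₘ (suc m)
  s-step m 1≤m =
    length-filter-mono (Aₘ≢0? m) (Aₘ≢0? (suc m)) (Pointwise-refl (A≢0-step m 1≤m) {applyUpTo suc n})

  d′+[n∸d+1]≡n : d′ + (n ∸ d + 1) ≡ n
  d′+[n∸d+1]≡n = trans (cong (d′ +_) (+-comm (n ∸ d) 1)) (trans (+-suc d′ (n ∸ d)) (m+[n∸m]≡n d≤n))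
    where
    d≤n : d ≤ n
    d≤n = A≢0⇒≤length F H F (idEmb F) (proj₁ (proj₂ md))

  s-bound : ∀ m → 1 ≤ m → sₘ m ≤ n ∸ d + 1
  s-bound m 1≤m = subst (λ N → countUpTo (Aₘ≢0? m) N ≤ n ∸ d + 1) d′+[n∸d+1]≡n
    (countUpTo-≤ (Aₘ≢0? m) d′ (n ∸ d + 1) (no-weight-below-d m 1≤m))

  s-full : ∀ m → 1 ≤ m → (∀ i → InSₘ m i ⇔ (d ≤ i × i ≤ n)) → sₘ m ≡ n ∸ d + 1
  s-full m 1≤m spectrum = subst (λ N → countUpTo (Aₘ≢0? m) N ≡ n ∸ d + 1) d′+[n∸d+1]≡n
    (countUpTo-interval (Aₘ≢0? m) d′ (n ∸ d + 1) (no-weight-below-d m 1≤m) λ {i} i<k →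
      proj₂ (Equivalence.from (spectrum (suc (d′ + i))) (s≤s (m≤m+n d′ i) , in-block d′+[n∸d+1]≡n i<k)))

  s-gap : ∀ m → 1 ≤ m → d < n →
          (∀ i → InSₘ m i ⇔ (i ≡ d ⊎ (d + 2 ≤ i × i ≤ n))) → sₘ m ≡ n ∸ d
  s-gap m 1≤m d<n spectrum = trans (subst (λ N → countUpTo (Aₘ≢0? m) N ≡ suc k) d′+[k+2]≡n
      (countUpTo-gap (Aₘ≢0? m) d′ k (no-weight-below-d m 1≤m) d∈S d+1∉S λ {i} i<k →
        proj₂ (Equivalence.from (spectrum (suc (d′ + suc (suc i))))
          (inj₂ (s≤s (+-monoʳ-≤ d′ (s≤s (s≤s z≤n))) , in-block d′+[k+2]≡n (s≤s (s≤s i<k)))))))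
    (sym n∸d≡k+1)
    where
    k : ℕ
    k = n ∸ suc d
    d+1+k≡n : suc d + k ≡ n
    d+1+k≡n = m+[n∸m]≡n d<n
    d′+[k+2]≡n : d′ + suc (suc k) ≡ n
    d′+[k+2]≡n = trans (+-suc d′ (suc k)) (trans (cong suc (+-suc d′ k)) d+1+k≡n)
    n∸d≡k+1 : n ∸ d ≡ suc k
    n∸d≡k+1 = trans (cong (_∸ d) (sym (trans (cong suc (+-suc d′ k)) d+1+k≡n))) (m+n∸m≡n d (suc k))
    d∈S : Aₘ m d ≢ 0
    d∈S = proj₂ (Equivalence.from (spectrum d) (inj₁ refl))
    d+1∉S : ¬ (Aₘ m (suc d) ≢ 0)
    d+1∉S A≢0 with Equivalence.to (spectrum (suc d)) (s≤s z≤n , A≢0)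
    ... | inj₁ ()
    ... | inj₂ (d+2≤d+1 , _) = <-irrefl refl (subst (_≤ suc d) (+-comm d 2) d+2≤d+1)

  full-spectrum : ∀ m* → 1 ≤ m* → (∀ i → InSₘ m* i ⇔ (d ≤ i × i ≤ n)) → ∀ m → m* ≤ m →
                  (∀ i → InSₘ m i ⇔ (d ≤ i × i ≤ n)) × sₘ m ≡ n ∸ d + 1
  full-spectrum m* 1≤m* spec m m*≤m = spectrum , s-full m 1≤m spectrum
    where
    1≤m : 1 ≤ m
    1≤m = ≤-trans 1≤m* m*≤m
    spectrum : ∀ i → InSₘ m i ⇔ (d ≤ i × i ≤ n)
    spectrum i = mk⇔ (InS-bounds m 1≤m i) λ range → InS-lift 1≤m* m*≤m i (Equivalence.from (spec i) range)

  gap-spectrum : ∀ m* → 1 ≤ m* → d < n → (∀ m → m* ≤ m → Aₘ m (d + 1) ≡ 0) →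
                 (∀ i → InSₘ m* i ⇔ (i ≡ d ⊎ (d + 2 ≤ i × i ≤ n))) → ∀ m → m* ≤ m →
                 (∀ i → InSₘ m i ⇔ (i ≡ d ⊎ (d + 2 ≤ i × i ≤ n))) × sₘ m ≡ n ∸ d
  gap-spectrum m* 1≤m* d<n gap spec m m*≤m = spectrum , s-gap m 1≤m d<n spectrum
    where
    1≤m : 1 ≤ m
    1≤m = ≤-trans 1≤m* m*≤m
    in-gap-range : ∀ i → InSₘ m i → i ≡ d ⊎ (d + 2 ≤ i × i ≤ n)
    in-gap-range i i∈S with InS-bounds m 1≤m i i∈S
    ... | d≤i , i≤n with m≤n⇒m<n∨m≡n d≤i
    ...   | inj₂ d≡i = inj₁ (sym d≡i)
    ...   | inj₁ d<i with m≤n⇒m<n∨m≡n d<i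
    ...     | inj₂ refl  = contradiction (subst (λ j → Aₘ m j ≡ 0) (+-comm d 1) (gap m m*≤m)) (proj₂ i∈S)
    ...     | inj₁ d+1<i = inj₂ (subst (_≤ i) (+-comm 2 d) d+1<i , i≤n)
    spectrum : ∀ i → InSₘ m i ⇔ (i ≡ d ⊎ (d + 2 ≤ i × i ≤ n))
    spectrum i = mk⇔ (in-gap-range i) λ range → InS-lift 1≤m* m*≤m i (Equivalence.from (spec i) range)

lemma3p2 : (F : FiniteField) (E : ℕ → FiniteField)
           (ι : ∀ m → Embedding F (E m))
           (sizeE : ∀ m → 1 ≤ m → order (E m) ≡ order F ^ m)
           (n r d : ℕ) (H : Fin r → Fin n → Carrier F)
           → MinDist F H d
           → (∀ m → 1 ≤ m → ∀ i → InS F (E m) (ι m) H i → InS F (E (suc m)) (ι (suc m)) H i)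
           × (∀ m → 1 ≤ m → ∀ i → InS F (E m) (ι m) H i → d ≤ i × i ≤ n)
           × (∀ m → 1 ≤ m → s F (E m) (ι m) H ≤ s F (E (suc m)) (ι (suc m)) H
                           × s F (E m) (ι m) H ≤ n ∸ d + 1)
           × (∀ m* → 1 ≤ m*
              → (∀ i → InS F (E m*) (ι m*) H i ⇔ (d ≤ i × i ≤ n))
              → ∀ m → m* ≤ m
              → (∀ i → InS F (E m) (ι m) H i ⇔ (d ≤ i × i ≤ n))
                × s F (E m) (ι m) H ≡ n ∸ d + 1)
           × (∀ m* → 1 ≤ m* → d < n
              → (∀ m → m* ≤ m → A F (E m) (ι m) H (d + 1) ≡ 0)
              → (∀ i → InS F (E m*) (ι m*) H i ⇔ (i ≡ d ⊎ (d + 2 ≤ i × i ≤ n)))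
              → ∀ m → m* ≤ m
              → (∀ i → InS F (E m) (ι m) H i ⇔ (i ≡ d ⊎ (d + 2 ≤ i × i ≤ n)))
                × s F (E m) (ι m) H ≡ n ∸ d)
lemma3p2 F E ι sizeE n r zero     H (() , _)
lemma3p2 F E ι sizeE n r (suc d′) H md =
  InS-step , InS-bounds , (λ m 1≤m → s-step m 1≤m , s-bound m 1≤m) , full-spectrum , gap-spectrum
  where open LiftedCodes F E ι sizeE H d′ md
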